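{- For every class of predicates $\mathbb{P}$, every safety problem that is provable in $\mathbf{FBI}^{\mathbb{P}}_n$ is also provable in $\mathbf{F}^{\mathbb{P}_n}$, where $\mathbb{P}_n$ consists of all Boolean combinations of at most $n$ predicates from $\mathbb{P}$. However, for every $n>0$ there exist a set of predicates $\mathbb{P}$ and a safety problem $\Pi$ such that $\Pi$ is provable in $\mathbf{FBI}^{\mathbb{P}}_n$ but not provable in any of $\mathbf{FBI}^{\mathbb{P}}_{n-1}$, $\mathbf{FI}^{\mathbb{P}}$, or $\mathbf{F}^{\mathbb{P}}$.
   Context: Let $\Sigma$ be a first-order vocabulary and $\Sigma'$ its primed copy; $\varphi'$ denotes $\varphi$ with every symbol primed. A safety problem is a triple $(\iota,\tau,\beta)$ of closed formulas, $\iota,\beta$ over $\Sigma$ and $\tau$ over $\Sigma\cup\Sigma'$. $\tau^{ -1}$ is obtained from $\tau$ by swapping each symbol of $\Sigma$ with its primed counterpart. $A\Rightarrow B$ denotes validity of $A\to B$. Rules: (Ind): with no premises, conclude $(\iota,\tau,\neg\varphi)$ provided $\iota\Rightarrow\varphi$ and $\varphi\wedge\tau\Rightarrow\varphi'$; (Cons): from $(\iota,\tau,\neg\varphi)$ conclude $(\iota,\tau,\beta)$ provided $\varphi\Rightarrow\neg\beta$; (Inc): from premises $(\iota,\tau,\neg\varphi)$ and $(\iota\wedge\varphi,\tau\wedge\varphi\wedge\varphi',\beta\wedge\varphi)$ conclude $(\iota,\tau,\beta)$; (Rev): from $(\beta,\tau^{ -1},\iota)$ conclude $(\iota,\tau,\beta)$.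 System $\mathbf{F}$ = \{(Ind),(Cons)\}; $\mathbf{FI}$ = \{(Ind),(Cons),(Inc)\}; $\mathbf{FBI}$ = \{(Ind),(Cons),(Inc),(Rev)\}. A proof of $\Pi$ is a finite tree of safety problems with root $\Pi$, each node the conclusion of a rule applied to its children; $\Pi$ is provable if it has a proof. For a class of predicates $\mathbb{P}$, a superscript $\mathbb{P}$ restricts every application of (Ind) to $\varphi\in\mathbb{P}$, and a subscript $n$ additionally allows at most $n$ applications of (Ind) in a proof. -}

module Defs where

open import Data.Nat using (ℕ; zero; suc; _+_; _≤_)
open import Data.Fin using (Fin) renaming (zero to fzero; suc to fsuc)
open import Data.Vec using (Vec; []; _∷_)
open import Data.Bool using (Bool; true; false; T)
open import Data.Sum using (_⊎_; inj₁; inj₂; [_,_])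
open import Data.Product using (Σ; _×_; _,_)
open import Data.Unit using (⊤)
open import Data.Empty using (⊥)
open import Relation.Nullary using (¬_)
open import Relation.Binary.PropositionalEquality using (_≡_; refl; subst; sym)

record Vocab : Set₁ where
  field
    FunSym : Set
    funAr  : FunSym → ℕ
    RelSym : Set
    relAr  : RelSym → ℕ
open Vocab public

-- Σ ∪ Σ' : inj₁ = unprimed symbols, inj₂ = primed copies
Primed : Vocab → Vocab
Primed V = record
  { FunSym = FunSym V ⊎ FunSym V
  ; funAr  = [ funAr V , funAr V ]
  ; RelSym = RelSym V ⊎ RelSym V
  ; relAr  = [ relAr V , relAr V ]
  }

record VMor (V W : Vocab) : Set where
  field
    fmap : FunSym V → FunSym W
    fAr  : ∀ f → funAr W (fmap f) ≡ funAr V f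
    rmap : RelSym V → RelSym W
    rAr  : ∀ r → relAr W (rmap r) ≡ relAr V r
open VMor public

-- Syntax (de Bruijn variables; Formula V 0 = closed formulas)

data Term (V : Vocab) (n : ℕ) : Set where
  var : Fin n → Term V n
  app : (f : FunSym V) → Vec (Term V n) (funAr V f) → Term V n

infixr 6 _∧ᶠ_
infixr 5 _∨ᶠ_
infixr 4 _⇒ᶠ_

data Formula (V : Vocab) (n : ℕ) : Set where
  rel   : (r : RelSym V) → Vec (Term V n) (relAr V r) → Formula V n
  _≐_   : Term V n → Term V n → Formula V n
  ⊤ᶠ ⊥ᶠ : Formula V n
  ¬ᶠ_   : Formula V n → Formula V n
  _∧ᶠ_ _∨ᶠ_ _⇒ᶠ_ : Formula V n → Formula V n → Formula V n
  ∀ᶠ ∃ᶠ : Formula V (suc n) → Formula V n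

mutual
  renTerm : ∀ {V W n} → VMor V W → Term V n → Term W n
  renTerm m (var i) = var i
  renTerm m (app f ts) =
    app (fmap m f) (subst (Vec _) (sym (fAr m f)) (renTerms m ts))

  renTerms : ∀ {V W n k} → VMor V W → Vec (Term V n) k → Vec (Term W n) k
  renTerms m [] = []
  renTerms m (t ∷ ts) = renTerm m t ∷ renTerms m ts

ren : ∀ {V W n} → VMor V W → Formula V n → Formula W n
ren m (rel r ts) = rel (rmap m r) (subst (Vec _) (sym (rAr m r)) (renTerms m ts))
ren m (s ≐ t) = renTerm m s ≐ renTerm m t
ren m ⊤ᶠ = ⊤ᶠ
ren m ⊥ᶠ = ⊥ᶠ
ren m (¬ᶠ φ) = ¬ᶠ ren m φ
ren m (φ ∧ᶠ ψ) = ren m φ ∧ᶠ ren m ψ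
ren m (φ ∨ᶠ ψ) = ren m φ ∨ᶠ ren m ψ
ren m (φ ⇒ᶠ ψ) = ren m φ ⇒ᶠ ren m ψ
ren m (∀ᶠ φ) = ∀ᶠ (ren m φ)
ren m (∃ᶠ φ) = ∃ᶠ (ren m φ)

unprimeMor : ∀ {V} → VMor V (Primed V)
unprimeMor = record { fmap = inj₁ ; fAr = λ _ → refl ; rmap = inj₁ ; rAr = λ _ → refl }

primeMor : ∀ {V} → VMor V (Primed V)
primeMor = record { fmap = inj₂ ; fAr = λ _ → refl ; rmap = inj₂ ; rAr = λ _ → refl }

swap : ∀ {A : Set} → A ⊎ A → A ⊎ A
swap (inj₁ x) = inj₂ x
swap (inj₂ x) = inj₁ x

swapMor : ∀ {V} → VMor (Primed V) (Primed V)
swapMor {V} = record { fmap = swap ; fAr = fa ; rmap = swap ; rAr = ra }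
  where
  fa : ∀ f → funAr (Primed V) (swap f) ≡ funAr (Primed V) f
  fa (inj₁ _) = refl
  fa (inj₂ _) = refl
  ra : ∀ r → relAr (Primed V) (swap r) ≡ relAr (Primed V) r
  ra (inj₁ _) = refl
  ra (inj₂ _) = refl

unp : ∀ {V n} → Formula V n → Formula (Primed V) n
unp = ren unprimeMor

prime : ∀ {V n} → Formula V n → Formula (Primed V) n
prime = ren primeMor

inverse : ∀ {V n} → Formula (Primed V) n → Formula (Primed V) n
inverse = ren swapMor

-- Classical Tarskian semantics, rendered via ¬¬-stable clauses
-- (Gödel–Gentzen style), so that validity is classical validity.

record Structure (V : Vocab) : Set₁ where
  field
    D    : Set
    elt  : D                                  -- domains are nonempty
    funI : (f : FunSym V) → Vec D (funAr V f) → D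
    relI : (r : RelSym V) → Vec D (relAr V r) → Set
open Structure public

cons : ∀ {A : Set} {n} → A → (Fin n → A) → Fin (suc n) → A
cons a ρ fzero = a
cons a ρ (fsuc i) = ρ i

mutual
  evalT : ∀ {V n} (M : Structure V) → (Fin n → D M) → Term V n → D M
  evalT M ρ (var i) = ρ i
  evalT M ρ (app f ts) = funI M f (evalTs M ρ ts)

  evalTs : ∀ {V n k} (M : Structure V) → (Fin n → D M) → Vec (Term V n) k → Vec (D M) k
  evalTs M ρ [] = []
  evalTs M ρ (t ∷ ts) = evalT M ρ t ∷ evalTs M ρ ts

Sat : ∀ {V n} (M : Structure V) → (Fin n → D M) → Formula V n → Set
Sat M ρ (rel r ts) = ¬ ¬ relI M r (evalTs M ρ ts)
Sat M ρ (s ≐ t) = ¬ ¬ (evalT M ρ s ≡ evalT M ρ t)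
Sat M ρ ⊤ᶠ = ⊤
Sat M ρ ⊥ᶠ = ⊥
Sat M ρ (¬ᶠ φ) = ¬ Sat M ρ φ
Sat M ρ (φ ∧ᶠ ψ) = Sat M ρ φ × Sat M ρ ψ
Sat M ρ (φ ∨ᶠ ψ) = ¬ (¬ Sat M ρ φ × ¬ Sat M ρ ψ)
Sat M ρ (φ ⇒ᶠ ψ) = Sat M ρ φ → Sat M ρ ψ
Sat M ρ (∀ᶠ φ) = (d : D M) → Sat M (cons d ρ) φ
Sat M ρ (∃ᶠ φ) = ¬ ((d : D M) → ¬ Sat M (cons d ρ) φ)

noVars : ∀ {A : Set} → Fin 0 → A
noVars ()

Valid : ∀ {V} → Formula V 0 → Set₁
Valid {V} φ = (M : Structure V) → Sat M noVars φ

_⟹_ : ∀ {V} → Formula V 0 → Formula V 0 → Set₁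
A ⟹ B = Valid (A ⇒ᶠ B)

record SafetyProblem (V : Vocab) : Set where
  constructor ⟨_,_,_⟩
  field
    init  : Formula V 0
    trans : Formula (Primed V) 0
    bad   : Formula V 0

-- which of (Inc), (Rev) are available; (Ind), (Cons) are always present
record System : Set where
  field
    hasInc hasRev : Bool
open System public

𝐅 𝐅𝐈 𝐅𝐁𝐈 : System
𝐅   = record { hasInc = false ; hasRev = false }
𝐅𝐈  = record { hasInc = true  ; hasRev = false }
𝐅𝐁𝐈 = record { hasInc = true  ; hasRev = true  }

Pred : Vocab → Set₁
Pred V = Formula V 0 → Set

data Deriv {V : Vocab} (S : System) (P : Pred V) : SafetyProblem V → Set₁ where
  ind  : ∀ {ι τ φ} → P φ → ι ⟹ φ → (unp φ ∧ᶠ τ) ⟹ prime φ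
       → Deriv S P ⟨ ι , τ , ¬ᶠ φ ⟩
  cons' : ∀ {ι τ φ β} → Deriv S P ⟨ ι , τ , ¬ᶠ φ ⟩ → φ ⟹ (¬ᶠ β)
       → Deriv S P ⟨ ι , τ , β ⟩
  inc  : ∀ {ι τ φ β} → T (hasInc S)
       → Deriv S P ⟨ ι , τ , ¬ᶠ φ ⟩
       → Deriv S P ⟨ ι ∧ᶠ φ , τ ∧ᶠ unp φ ∧ᶠ prime φ , β ∧ᶠ φ ⟩
       → Deriv S P ⟨ ι , τ , β ⟩
  rev  : ∀ {ι τ β} → T (hasRev S)
       → Deriv S P ⟨ β , inverse τ , ι ⟩
       → Deriv S P ⟨ ι , τ , β ⟩

indCount : ∀ {V S P Π} → Deriv {V} S P Π → ℕ
indCount (ind _ _ _) = 1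
indCount (cons' d _) = indCount d
indCount (inc _ d e) = indCount d + indCount e
indCount (rev _ d) = indCount d

Provable : ∀ {V} → System → Pred V → SafetyProblem V → Set₁
Provable S P Π = Deriv S P Π

Provable≤ : ∀ {V} → System → Pred V → ℕ → SafetyProblem V → Set₁
Provable≤ S P n Π = Σ (Deriv S P Π) (λ d → indCount d ≤ n)

data BExpr (k : ℕ) : Set where
  atom : Fin k → BExpr k
  tt ff : BExpr k
  not : BExpr k → BExpr k
  and or imp : BExpr k → BExpr k → BExpr k

inst : ∀ {V k} → (Fin k → Formula V 0) → BExpr k → Formula V 0
inst ps (atom i) = ps i
inst ps tt = ⊤ᶠ
inst ps ff = ⊥ᶠ
inst ps (not e) = ¬ᶠ inst ps e
inst ps (and e f) = inst ps e ∧ᶠ inst ps f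
inst ps (or e f) = inst ps e ∨ᶠ inst ps f
inst ps (imp e f) = inst ps e ⇒ᶠ inst ps f

BoolComb : ∀ {V} → Pred V → ℕ → Pred V
BoolComb {V} P n φ =
  Σ ℕ λ k → k ≤ n × Σ (Fin k → Formula V 0) λ ps →
    ((i : Fin k) → P (ps i)) × Σ (BExpr k) λ e → inst ps e ≡ φ

{-# OPTIONS --safe #-}
module Submission where

-- Every proof tree yields an inductive invariant of its root problem: (Ind) contributes its own
-- invariant, (Cons) keeps it, (Inc) conjoins the invariants of its two premises (the first one
-- implies φ, which is all the strengthened second problem assumes), and (Rev) negates the
-- invariant of the reversed problem. This invariant is a Boolean combination of one predicate
-- per (Ind), so a single (Ind) followed by (Cons) proves the problem in 𝐅.
--
-- For the separation take k nullary atoms, ℙ = the atoms, and the problem (¬ ⋀ p, ⊥, ⋀ p). Its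
-- reverse (⋀ p, ⊥, ¬ ⋀ p) is proved by k inductions chained with (Inc). Without (Rev) the leftmost
-- (Ind) would need ¬ ⋀ p ⟹ pᵢ, refuted by the all-false valuation. With fewer than k inductions
-- the invariant above misses some atom pₓ, so it cannot tell the initial valuation "all atoms but
-- pₓ" from the bad valuation "all atoms".

open import Defs
open import Data.Nat using (ℕ; zero; suc; _+_; _≤_; _<_; _∸_; s≤s; z≤n)
open import Data.Nat.Properties using (≤-trans; +-mono-≤; ≤-<-trans; ≤⇒≯; n<1+n)
open import Data.Fin using (Fin; _↑ˡ_; _↑ʳ_; splitAt) renaming (zero to fzero; suc to fsuc)
open import Data.Fin.Properties using (¬∀⟶∃¬; any?; _≟_; injective⇒≤)
open import Data.Vec using (Vec; []; _∷_)
open import Data.Vec.Functional using (_++_)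
open import Data.Vec.Functional.Properties using (lookup-++ˡ; lookup-++ʳ)
open import Data.Sum using (inj₁; inj₂)
open import Data.Product using (Σ; ∃; _×_; _,_; proj₁; proj₂)
open import Data.Product.Function.NonDependent.Propositional using (_×-⇔_)
open import Data.Bool using (T)
open import Data.Unit using (⊤; tt)
open import Data.Empty using (⊥; ⊥-elim)
open import Function using (_∘_; _⇔_; mk⇔; Equivalence)
open import Function.Related.Propositional using (≡⇒; equivalence)
open import Function.Related.TypeIsomorphisms using (→-cong-⇔; ¬-cong-⇔)
open import Relation.Nullary using (¬_)
open import Relation.Nullary.Negation using (Stable)
open import Relation.Binary.PropositionalEquality
  using (_≡_; _≢_; refl; subst; sym; trans; cong; cong₂)

open Equivalence using (to; from)

variable
  V W : Vocab
  n : ℕ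

_⊨_ : Structure V → Formula V 0 → Set
M ⊨ φ = Sat M noVars φ

Sat-stable : (M : Structure V) (ρ : Fin n → D M) (φ : Formula V n) → Stable (Sat M ρ φ)
Sat-stable M ρ (rel r ts) ¬¬s ¬r = ¬¬s (λ ¬s → ¬s ¬r)
Sat-stable M ρ (s ≐ t) ¬¬s ¬e = ¬¬s (λ ¬s → ¬s ¬e)
Sat-stable M ρ ⊤ᶠ ¬¬s = tt
Sat-stable M ρ ⊥ᶠ ¬¬s = ¬¬s (λ s → s)
Sat-stable M ρ (¬ᶠ φ) ¬¬s s = ¬¬s (λ ¬s → ¬s s)
Sat-stable M ρ (φ ∧ᶠ ψ) ¬¬s =
  Sat-stable M ρ φ (λ ¬a → ¬¬s (¬a ∘ proj₁)) , Sat-stable M ρ ψ (λ ¬b → ¬¬s (¬b ∘ proj₂))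
Sat-stable M ρ (φ ∨ᶠ ψ) ¬¬s neither = ¬¬s (λ ¬s → ¬s neither)
Sat-stable M ρ (φ ⇒ᶠ ψ) ¬¬s a = Sat-stable M ρ ψ (λ ¬b → ¬¬s (λ f → ¬b (f a)))
Sat-stable M ρ (∀ᶠ φ) ¬¬s d = Sat-stable M (cons d ρ) φ (λ ¬s → ¬¬s (λ f → ¬s (f d)))
Sat-stable M ρ (∃ᶠ φ) ¬¬s none = ¬¬s (λ ¬s → ¬s none)

Π-cong-⇔ : {X : Set} {A B : X → Set} →
  (∀ x → A x ⇔ B x) → ((x : X) → A x) ⇔ ((x : X) → B x)
Π-cong-⇔ A⇔B = mk⇔ (λ f x → to (A⇔B x) (f x)) (λ f x → from (A⇔B x) (f x))

reduct : VMor V W → Structure W → Structure V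
reduct m M = record
  { D    = D M
  ; elt  = elt M
  ; funI = λ f xs → funI M (fmap m f) (subst (Vec (D M)) (sym (fAr m f)) xs)
  ; relI = λ r xs → relI M (rmap m r) (subst (Vec (D M)) (sym (rAr m r)) xs)
  }

evalTs-subst : ∀ {k l} (M : Structure V) (ρ : Fin n → D M) (k≡l : k ≡ l) (ts : Vec (Term V n) k) →
  evalTs M ρ (subst (Vec (Term V n)) k≡l ts) ≡ subst (Vec (D M)) k≡l (evalTs M ρ ts)
evalTs-subst M ρ refl ts = refl

mutual
  evalT-ren : (m : VMor V W) (M : Structure W) (ρ : Fin n → D M) (t : Term V n) →
    evalT M ρ (renTerm m t) ≡ evalT (reduct m M) ρ t
  evalT-ren m M ρ (var i) = refl
  evalT-ren m M ρ (app f ts) = cong (funI M (fmap m f)) (evalTs-ren-subst m M ρ (sym (fAr m f)) ts)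

  evalTs-ren : ∀ {k} (m : VMor V W) (M : Structure W) (ρ : Fin n → D M) (ts : Vec (Term V n) k) →
    evalTs M ρ (renTerms m ts) ≡ evalTs (reduct m M) ρ ts
  evalTs-ren m M ρ [] = refl
  evalTs-ren m M ρ (t ∷ ts) = cong₂ _∷_ (evalT-ren m M ρ t) (evalTs-ren m M ρ ts)

  evalTs-ren-subst : ∀ {k l} (m : VMor V W) (M : Structure W) (ρ : Fin n → D M)
    (k≡l : k ≡ l) (ts : Vec (Term V n) k) →
    evalTs M ρ (subst (Vec (Term W n)) k≡l (renTerms m ts))
      ≡ subst (Vec (D M)) k≡l (evalTs (reduct m M) ρ ts)
  evalTs-ren-subst m M ρ k≡l ts =
    trans (evalTs-subst M ρ k≡l (renTerms m ts))
          (cong (subst (Vec (D M)) k≡l) (evalTs-ren m M ρ ts))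

Sat-ren : (m : VMor V W) (M : Structure W) (ρ : Fin n → D M) (φ : Formula V n) →
  Sat M ρ (ren m φ) ⇔ Sat (reduct m M) ρ φ
Sat-ren m M ρ (rel r ts) =
  ≡⇒ {k = equivalence}
    (cong (λ xs → ¬ ¬ relI M (rmap m r) xs) (evalTs-ren-subst m M ρ (sym (rAr m r)) ts))
Sat-ren m M ρ (s ≐ t) =
  ≡⇒ {k = equivalence} (cong₂ (λ a b → ¬ ¬ (a ≡ b)) (evalT-ren m M ρ s) (evalT-ren m M ρ t))
Sat-ren m M ρ ⊤ᶠ = mk⇔ (λ s → s) (λ s → s)
Sat-ren m M ρ ⊥ᶠ = mk⇔ (λ s → s) (λ s → s)
Sat-ren m M ρ (¬ᶠ φ) = ¬-cong-⇔ (Sat-ren m M ρ φ)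
Sat-ren m M ρ (φ ∧ᶠ ψ) = Sat-ren m M ρ φ ×-⇔ Sat-ren m M ρ ψ
Sat-ren m M ρ (φ ∨ᶠ ψ) = ¬-cong-⇔ (¬-cong-⇔ (Sat-ren m M ρ φ) ×-⇔ ¬-cong-⇔ (Sat-ren m M ρ ψ))
Sat-ren m M ρ (φ ⇒ᶠ ψ) = →-cong-⇔ (Sat-ren m M ρ φ) (Sat-ren m M ρ ψ)
Sat-ren m M ρ (∀ᶠ φ) = Π-cong-⇔ (λ d → Sat-ren m M (cons d ρ) φ)
Sat-ren m M ρ (∃ᶠ φ) = ¬-cong-⇔ (Π-cong-⇔ (λ d → ¬-cong-⇔ (Sat-ren m M (cons d ρ) φ)))

⟹-ren : (m : VMor V W) {φ ψ : Formula V 0} → φ ⟹ ψ → ren m φ ⟹ ren m ψ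
⟹-ren m {φ} {ψ} φ⟹ψ M ⊨φ =
  from (Sat-ren m M noVars ψ) (φ⟹ψ (reduct m M) (to (Sat-ren m M noVars φ) ⊨φ))

mutual
  renTerm-swap-involutive : (t : Term (Primed V) n) → renTerm swapMor (renTerm swapMor t) ≡ t
  renTerm-swap-involutive (var i) = refl
  renTerm-swap-involutive (app (inj₁ f) ts) = cong (app (inj₁ f)) (renTerms-swap-involutive ts)
  renTerm-swap-involutive (app (inj₂ f) ts) = cong (app (inj₂ f)) (renTerms-swap-involutive ts)

  renTerms-swap-involutive : ∀ {k} (ts : Vec (Term (Primed V) n) k) →
    renTerms swapMor (renTerms swapMor ts) ≡ ts
  renTerms-swap-involutive [] = refl
  renTerms-swap-involutive (t ∷ ts) =
    cong₂ _∷_ (renTerm-swap-involutive t) (renTerms-swap-involutive ts)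

inverse-involutive : (φ : Formula (Primed V) n) → inverse (inverse φ) ≡ φ
inverse-involutive (rel (inj₁ r) ts) = cong (rel (inj₁ r)) (renTerms-swap-involutive ts)
inverse-involutive (rel (inj₂ r) ts) = cong (rel (inj₂ r)) (renTerms-swap-involutive ts)
inverse-involutive (s ≐ t) = cong₂ _≐_ (renTerm-swap-involutive s) (renTerm-swap-involutive t)
inverse-involutive ⊤ᶠ = refl
inverse-involutive ⊥ᶠ = refl
inverse-involutive (¬ᶠ φ) = cong ¬ᶠ_ (inverse-involutive φ)
inverse-involutive (φ ∧ᶠ ψ) = cong₂ _∧ᶠ_ (inverse-involutive φ) (inverse-involutive ψ)
inverse-involutive (φ ∨ᶠ ψ) = cong₂ _∨ᶠ_ (inverse-involutive φ) (inverse-involutive ψ)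
inverse-involutive (φ ⇒ᶠ ψ) = cong₂ _⇒ᶠ_ (inverse-involutive φ) (inverse-involutive ψ)
inverse-involutive (∀ᶠ φ) = cong ∀ᶠ (inverse-involutive φ)
inverse-involutive (∃ᶠ φ) = cong ∃ᶠ (inverse-involutive φ)

mapAtoms : ∀ {a b} → (Fin a → Fin b) → BExpr a → BExpr b
mapAtoms f (atom i) = atom (f i)
mapAtoms f tt = tt
mapAtoms f ff = ff
mapAtoms f (not e) = not (mapAtoms f e)
mapAtoms f (and e e′) = and (mapAtoms f e) (mapAtoms f e′)
mapAtoms f (or e e′) = or (mapAtoms f e) (mapAtoms f e′)
mapAtoms f (imp e e′) = imp (mapAtoms f e) (mapAtoms f e′)

inst-mapAtoms : ∀ {a b} {ps : Fin b → Formula V 0} {qs : Fin a → Formula V 0} {f : Fin a → Fin b} →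
  (∀ i → ps (f i) ≡ qs i) → ∀ e → inst ps (mapAtoms f e) ≡ inst qs e
inst-mapAtoms ps∘f≗qs (atom i) = ps∘f≗qs i
inst-mapAtoms ps∘f≗qs tt = refl
inst-mapAtoms ps∘f≗qs ff = refl
inst-mapAtoms ps∘f≗qs (not e) = cong ¬ᶠ_ (inst-mapAtoms ps∘f≗qs e)
inst-mapAtoms ps∘f≗qs (and e e′) = cong₂ _∧ᶠ_ (inst-mapAtoms ps∘f≗qs e) (inst-mapAtoms ps∘f≗qs e′)
inst-mapAtoms ps∘f≗qs (or e e′) = cong₂ _∨ᶠ_ (inst-mapAtoms ps∘f≗qs e) (inst-mapAtoms ps∘f≗qs e′)
inst-mapAtoms ps∘f≗qs (imp e e′) = cong₂ _⇒ᶠ_ (inst-mapAtoms ps∘f≗qs e) (inst-mapAtoms ps∘f≗qs e′)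

Sat-inst-cong : ∀ {k} (ps : Fin k → Formula V 0) {M N : Structure V} →
  (∀ i → M ⊨ ps i ⇔ N ⊨ ps i) → ∀ e → M ⊨ inst ps e ⇔ N ⊨ inst ps e
Sat-inst-cong ps atoms⇔ (atom i) = atoms⇔ i
Sat-inst-cong ps atoms⇔ tt = mk⇔ (λ s → s) (λ s → s)
Sat-inst-cong ps atoms⇔ ff = mk⇔ (λ s → s) (λ s → s)
Sat-inst-cong ps atoms⇔ (not e) = ¬-cong-⇔ (Sat-inst-cong ps atoms⇔ e)
Sat-inst-cong ps atoms⇔ (and e e′) = Sat-inst-cong ps atoms⇔ e ×-⇔ Sat-inst-cong ps atoms⇔ e′
Sat-inst-cong ps atoms⇔ (or e e′) =
  ¬-cong-⇔ (¬-cong-⇔ (Sat-inst-cong ps atoms⇔ e) ×-⇔ ¬-cong-⇔ (Sat-inst-cong ps atoms⇔ e′))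
Sat-inst-cong ps atoms⇔ (imp e e′) =
  →-cong-⇔ (Sat-inst-cong ps atoms⇔ e) (Sat-inst-cong ps atoms⇔ e′)

module _ {P : Pred V} where

  BoolComb-mono : ∀ {m φ} → m ≤ n → BoolComb P m φ → BoolComb P n φ
  BoolComb-mono m≤n (k , k≤m , rest) = k , ≤-trans k≤m m≤n , rest

  BoolComb-atom : ∀ {φ} → P φ → BoolComb P 1 φ
  BoolComb-atom {φ} Pφ = 1 , s≤s z≤n , (λ _ → φ) , (λ _ → Pφ) , atom fzero , refl

  BoolComb-¬ : ∀ {φ} → BoolComb P n φ → BoolComb P n (¬ᶠ φ)
  BoolComb-¬ (k , k≤n , ps , Pps , e , refl) = k , k≤n , ps , Pps , not e , refl

  BoolComb-∧ : ∀ {m φ ψ} → BoolComb P m φ → BoolComb P n ψ → BoolComb P (m + n) (φ ∧ᶠ ψ)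
  BoolComb-∧ (k , k≤m , ps , Pps , e , refl) (l , l≤n , qs , Pqs , f , refl) =
    k + l , +-mono-≤ k≤m l≤n , ps ++ qs , Pps++qs ,
    and (mapAtoms (_↑ˡ l) e) (mapAtoms (k ↑ʳ_) f) ,
    cong₂ _∧ᶠ_ (inst-mapAtoms (lookup-++ˡ ps qs) e) (inst-mapAtoms (lookup-++ʳ ps qs) f)
    where
    Pps++qs : ∀ i → P ((ps ++ qs) i)
    Pps++qs i with splitAt k i
    ... | inj₁ j = Pps j
    ... | inj₂ j = Pqs j

InductiveInvariant : SafetyProblem V → Formula V 0 → Set₁
InductiveInvariant ⟨ ι , τ , β ⟩ ψ = (ι ⟹ ψ) × ((unp ψ ∧ᶠ τ) ⟹ prime ψ) × (ψ ⟹ (¬ᶠ β))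

module _ {V : Vocab} {ι β : Formula V 0} {τ : Formula (Primed V) 0} where

  invariant-cons : ∀ {φ ψ} → InductiveInvariant ⟨ ι , τ , ¬ᶠ φ ⟩ ψ → φ ⟹ (¬ᶠ β) →
    InductiveInvariant ⟨ ι , τ , β ⟩ ψ
  invariant-cons (init , step , ψ⟹¬¬φ) φ⟹¬β =
    init , step , λ M ⊨ψ ⊨β → ψ⟹¬¬φ M ⊨ψ (λ ⊨φ → φ⟹¬β M ⊨φ ⊨β)

  invariant-inc : ∀ {φ ψ₁ ψ₂} → InductiveInvariant ⟨ ι , τ , ¬ᶠ φ ⟩ ψ₁ →
    InductiveInvariant ⟨ ι ∧ᶠ φ , τ ∧ᶠ unp φ ∧ᶠ prime φ , β ∧ᶠ φ ⟩ ψ₂ →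
    InductiveInvariant ⟨ ι , τ , β ⟩ (ψ₁ ∧ᶠ ψ₂)
  invariant-inc {φ} {ψ₁} (init₁ , step₁ , ψ₁⟹¬¬φ) (init₂ , step₂ , safe₂) =
    (λ M ⊨ι → let ⊨ψ₁ = init₁ M ⊨ι in ⊨ψ₁ , init₂ M (⊨ι , ψ₁⟹φ M ⊨ψ₁)) ,
    (λ M ((⊨ψ₁ , ⊨ψ₂) , ⊨τ) →
      let ⊨ψ₁′ = step₁ M (⊨ψ₁ , ⊨τ) in
      ⊨ψ₁′ , step₂ M (⊨ψ₂ , ⊨τ , ⟹-ren unprimeMor ψ₁⟹φ M ⊨ψ₁ , ⟹-ren primeMor ψ₁⟹φ M ⊨ψ₁′)) ,
    (λ M (⊨ψ₁ , ⊨ψ₂) ⊨β → safe₂ M ⊨ψ₂ (⊨β , ψ₁⟹φ M ⊨ψ₁))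
    where
    ψ₁⟹φ : ψ₁ ⟹ φ
    ψ₁⟹φ M ⊨ψ₁ = Sat-stable M noVars φ (ψ₁⟹¬¬φ M ⊨ψ₁)

  invariant-rev : ∀ {χ} → InductiveInvariant ⟨ β , inverse τ , ι ⟩ χ →
    InductiveInvariant ⟨ ι , τ , β ⟩ (¬ᶠ χ)
  invariant-rev {χ} (init , step , safe) =
    (λ M ⊨ι ⊨χ → safe M ⊨χ ⊨ι) ,
    (λ M (⊭χ , ⊨τ) ⊨χ′ → ⊭χ (backward M ⊨χ′ ⊨τ)) ,
    (λ M ⊭χ ⊨β → ⊭χ (init M ⊨β))
    where
    backward : ∀ M → M ⊨ prime χ → M ⊨ τ → M ⊨ unp χ
    backward M ⊨χ′ ⊨τ =
      from (Sat-ren unprimeMor M noVars χ)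
        (to (Sat-ren primeMor M′ noVars χ) (step M′ (⊨unpχ , ⊨τ⁻¹)))
      where
      -- The unprimed reduct of M′ is definitionally the primed reduct of M, and vice versa.
      M′ : Structure (Primed V)
      M′ = reduct swapMor M
      ⊨unpχ : M′ ⊨ unp χ
      ⊨unpχ = from (Sat-ren unprimeMor M′ noVars χ) (to (Sat-ren primeMor M noVars χ) ⊨χ′)
      ⊨τ⁻¹ : M′ ⊨ inverse τ
      ⊨τ⁻¹ = to (Sat-ren swapMor M noVars (inverse τ))
                (subst (M ⊨_) (sym (inverse-involutive τ)) ⊨τ)

invariant-of : ∀ {S} {P : Pred V} {Π} (d : Deriv S P Π) →
  Σ (Formula V 0) λ ψ → BoolComb P (indCount d) ψ × InductiveInvariant Π ψ
invariant-of {P = P} (ind {φ = φ} Pφ init step) =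
  φ , BoolComb-atom {P = P} Pφ , init , step , λ M ⊨φ ⊭φ → ⊭φ ⊨φ
invariant-of (cons' d φ⟹¬β) =
  let ψ , comb , inv = invariant-of d in ψ , comb , invariant-cons inv φ⟹¬β
invariant-of {P = P} (inc _ d₁ d₂) =
  let ψ₁ , comb₁ , inv₁ = invariant-of d₁
      ψ₂ , comb₂ , inv₂ = invariant-of d₂
  in ψ₁ ∧ᶠ ψ₂ , BoolComb-∧ {P = P} comb₁ comb₂ , invariant-inc inv₁ inv₂
invariant-of {P = P} (rev _ d) =
  let χ , comb , inv = invariant-of d in ¬ᶠ χ , BoolComb-¬ {P = P} comb , invariant-rev inv

provable≤⇒provable𝐅 : ∀ {S} {P : Pred V} {Π} → Provable≤ S P n Π → Provable 𝐅 (BoolComb P n) Π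
provable≤⇒provable𝐅 {P = P} (d , count≤n) =
  let ψ , comb , init , step , safe = invariant-of d
  in cons' (ind (BoolComb-mono {P = P} count≤n comb) init step) safe

invariants-provable≤ : ∀ {S} {P : Pred V} {m ι τ β} → T (hasInc S) →
  (qs : Fin (suc m) → Formula V 0) → (∀ i → P (qs i)) →
  (∀ i → ι ⟹ qs i) → (∀ i → (unp (qs i) ∧ᶠ τ) ⟹ prime (qs i)) →
  (∀ M → (∀ i → M ⊨ qs i) → ¬ M ⊨ β) →
  Provable≤ S P (suc m) ⟨ ι , τ , β ⟩
invariants-provable≤ {m = zero} _ qs Pqs init step excl =
  cons' (ind (Pqs fzero) (init fzero) (step fzero)) (λ M ⊨q ⊨β → excl M (λ { fzero → ⊨q }) ⊨β) ,
  s≤s z≤n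
invariants-provable≤ {m = suc m} hasInc qs Pqs init step excl =
  let d , count≤m = invariants-provable≤ hasInc (qs ∘ fsuc) (Pqs ∘ fsuc)
        (λ i M (⊨ι , _) → init (fsuc i) M ⊨ι)
        (λ i M (⊨q , ⊨τ , _) → step (fsuc i) M (⊨q , ⊨τ))
        (λ M ⊨qs (⊨β , ⊨q₀) → excl M (λ { fzero → ⊨q₀ ; (fsuc i) → ⊨qs i }) ⊨β)
  in inc hasInc (ind (Pqs fzero) (init fzero) (step fzero)) d , s≤s count≤m

leftmost-invariant : ∀ {S} {P : Pred V} {Π} → ¬ T (hasRev S) → Deriv S P Π →
  ∃ λ φ → P φ × SafetyProblem.init Π ⟹ φ
leftmost-invariant noRev (ind {φ = φ} Pφ init _) = φ , Pφ , init
leftmost-invariant noRev (cons' d _) = leftmost-invariant noRev d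
leftmost-invariant noRev (inc _ d _) = leftmost-invariant noRev d
leftmost-invariant noRev (rev hasRev _) = ⊥-elim (noRev hasRev)

nonSurjective : ∀ {c k} → c < k → (f : Fin c → Fin k) → ∃ λ x → ¬ ∃ λ i → f i ≡ x
nonSurjective {c} {k} c<k f =
  ¬∀⟶∃¬ k (λ x → ∃ λ i → f i ≡ x) (λ x → any? λ i → f i ≟ x) λ surj →
    ≤⇒≯ (injective⇒≤ {f = proj₁ ∘ surj} λ {x} {y} eq →
      trans (sym (proj₂ (surj x))) (trans (cong f eq) (proj₂ (surj y)))) c<k

⋀ : ∀ {k} → (Fin k → Formula V 0) → Formula V 0
⋀ {k = zero} φs = ⊤ᶠ
⋀ {k = suc k} φs = φs fzero ∧ᶠ ⋀ (φs ∘ fsuc)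

Sat-⋀ : ∀ {k} (M : Structure V) (φs : Fin k → Formula V 0) → M ⊨ ⋀ φs ⇔ (∀ i → M ⊨ φs i)
Sat-⋀ {k = zero} M φs = mk⇔ (λ _ ()) (λ _ → tt)
Sat-⋀ {k = suc k} M φs = mk⇔
  (λ { (⊨φ₀ , ⊨rest) → λ { fzero → ⊨φ₀ ; (fsuc i) → to (Sat-⋀ M (φs ∘ fsuc)) ⊨rest i } })
  (λ ⊨φs → ⊨φs fzero , from (Sat-⋀ M (φs ∘ fsuc)) (⊨φs ∘ fsuc))

Atoms : ℕ → Vocab
Atoms k = record { FunSym = ⊥ ; funAr = λ () ; RelSym = Fin k ; relAr = λ _ → 0 }

module _ {k : ℕ} where

  prop : Fin k → Formula (Atoms k) 0
  prop i = rel i []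

  IsAtom : Pred (Atoms k)
  IsAtom φ = ∃ λ i → prop i ≡ φ

  valuation : (Fin k → Set) → Structure (Atoms k)
  valuation v = record { D = ⊤ ; elt = tt ; funI = λ () ; relI = λ i _ → v i }

conjunctionProblem : (k : ℕ) → SafetyProblem (Atoms k)
conjunctionProblem k = ⟨ ¬ᶠ ⋀ prop , ⊥ᶠ , ⋀ prop ⟩

conjunctionProblem-provable≤ : ∀ {m} → Provable≤ 𝐅𝐁𝐈 IsAtom (suc m) (conjunctionProblem (suc m))
conjunctionProblem-provable≤ =
  let d , count≤ = invariants-provable≤ tt prop (λ i → i , refl)
        (λ i M ⊨⋀ → to (Sat-⋀ M prop) ⊨⋀ i) (λ i M ())
        (λ M ⊨atoms ⊭⋀ → ⊭⋀ (from (Sat-⋀ M prop) ⊨atoms))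
  in rev tt d , count≤

conjunctionProblem-unprovable-without-rev : ∀ {S k} → ¬ T (hasRev S) →
  ¬ Provable S IsAtom (conjunctionProblem k)
conjunctionProblem-unprovable-without-rev {k = k} noRev d with leftmost-invariant noRev d
... | _ , (i , refl) , init⟹pᵢ =
  init⟹pᵢ allFalse (λ ⊨⋀ → to (Sat-⋀ allFalse prop) ⊨⋀ i (λ ())) (λ ())
  where
  allFalse : Structure (Atoms k)
  allFalse = valuation (λ _ → ⊥)

unseen-atom : ∀ {k} {ψ : Formula (Atoms k) 0} → n < k → BoolComb IsAtom n ψ →
  ∃ λ x → valuation (λ i → i ≢ x) ⊨ ψ → valuation (λ _ → ⊤) ⊨ ψ
unseen-atom n<k (c , c≤n , ps , atomic , e , refl) =
  let x , unseen = nonSurjective (≤-<-trans c≤n n<k) (proj₁ ∘ atomic)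
  in x , to (Sat-inst-cong ps (agree x unseen) e)
  where
  agree : ∀ x → ¬ (∃ λ i → proj₁ (atomic i) ≡ x) →
    ∀ i → valuation (λ j → j ≢ x) ⊨ ps i ⇔ valuation (λ _ → ⊤) ⊨ ps i
  agree x unseen i =
    subst (λ φ → valuation (λ j → j ≢ x) ⊨ φ ⇔ valuation (λ _ → ⊤) ⊨ φ) (proj₂ (atomic i))
      (mk⇔ (λ _ ¬⊤ → ¬⊤ tt) (λ _ ¬j≢x → ¬j≢x λ j≡x → unseen (i , j≡x)))

conjunctionProblem-unprovable≤ : ∀ {S k} → n < k → ¬ Provable≤ S IsAtom n (conjunctionProblem k)
conjunctionProblem-unprovable≤ n<k (d , count≤n) =
  let ψ , comb , init , _ , safe = invariant-of d
      x , transfer = unseen-atom n<k (BoolComb-mono {P = IsAtom} count≤n comb)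
      allButX = valuation (λ i → i ≢ x)
      allTrue = valuation (λ _ → ⊤)
      allButX⊨init = λ ⊨⋀ → to (Sat-⋀ allButX prop) ⊨⋀ x (λ x≢x → x≢x refl)
      allTrue⊨bad = from (Sat-⋀ allTrue prop) (λ i ¬⊤ → ¬⊤ tt)
  in safe allTrue (transfer (init allButX allButX⊨init)) allTrue⊨bad

theorem4p14 :
    (∀ {V : Vocab} (P : Pred V) (n : ℕ) (Π : SafetyProblem V) →
       Provable≤ 𝐅𝐁𝐈 P n Π → Provable 𝐅 (BoolComb P n) Π)
    ×
    (∀ (n : ℕ) → 0 < n →
       Σ Vocab λ V → Σ (Pred V) λ P → Σ (SafetyProblem V) λ Π →
         Provable≤ 𝐅𝐁𝐈 P n Π
         × ¬ Provable≤ 𝐅𝐁𝐈 P (n ∸ 1) Π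
         × ¬ Provable 𝐅𝐈 P Π
         × ¬ Provable 𝐅 P Π)
theorem4p14 = (λ P n Π → provable≤⇒provable𝐅) , λ where
  (suc m) _ →
    Atoms (suc m) , IsAtom , conjunctionProblem (suc m) ,
    conjunctionProblem-provable≤ ,
    conjunctionProblem-unprovable≤ (n<1+n m) ,
    conjunctionProblem-unprovable-without-rev (λ ()) ,
    conjunctionProblem-unprovable-without-rev (λ ())
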